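{- Let $t>1$ be odd. Consider the graph with vertices $N_1,\dots,N_{4t}$ in which two distinct generalized coboundary matrices are adjacent iff they have a $-1$ entry in a common position of row $5$. This graph is the disjoint union of four cycles of length $t$, namely $N_{4t-3}-N_{4t-7}-\cdots-N_5-N_1-N_{4t-3}$, $N_{4t-2}-N_{4t-6}-\cdots-N_6-N_2-N_{4t-2}$, $N_{4t-1}-N_{4t-5}-\cdots-N_7-N_3-N_{4t-1}$, and $N_{4t}-N_{4t-4}-\cdots-N_8-N_4-N_{4t}$.
   Context: $G=\mathbb{Z}_t\times\mathbb{Z}_2^2=\langle x,u,v\mid x^t=u^2=v^2=1,\ uv=vu\rangle$, with elements ordered $g_{4m+1}=x^m$, $g_{4m+2}=x^mu$, $g_{4m+3}=x^mv$, $g_{4m+4}=x^muv$ for $0\le m\le t-1$. For $1\le i\le 4t$ let $\delta_i:G\to\{\pm1\}$ with $\delta_i(g)=-1$ iff $g=g_i$. The generalized coboundary matrix $N_i$ is the $4t\times4t$ matrix with $(s,j)$ entry $\delta_i(g_j)\delta_i(g_sg_j)$. -}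

module Defs where

open import Data.Nat as ℕ using (ℕ; NonZero)
open import Data.Nat.DivMod using (_%_; m%n<n)
open import Data.Fin as F using (Fin; toℕ; fromℕ<; remQuot; combine; opposite)
open import Data.Fin.Properties as FP using ()
open import Data.Bool using (Bool; true; false; _xor_)
open import Data.Bool.Properties as BP using ()
open import Data.Product using (_×_; _,_; Σ; ∃; proj₁; proj₂)
open import Data.Product.Properties using (≡-dec)
open import Data.Sum using (_⊎_)
open import Data.Integer as ℤ using (ℤ; +_; -_)
open import Relation.Nullary using (yes; no; ¬_)
open import Relation.Binary.PropositionalEquality using (_≡_)

-- The group G = Z_t × Z_2 × Z_2 ; an element (a , b , c) stands for x^a u^b v^c.
G : (t : ℕ) → Set
G t = Fin t × Bool × Bool

_+ₜ_ : {t : ℕ} .{{_ : NonZero t}} → Fin t → Fin t → Fin t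
_+ₜ_ {t} a b = fromℕ< (m%n<n (toℕ a ℕ.+ toℕ b) t)

mul : {t : ℕ} .{{_ : NonZero t}} → G t → G t → G t
mul (a , b , c) (a' , b' , c') = (a +ₜ a') , (b xor b') , (c xor c')

-- the enumeration of G: index i : Fin (t * 4) (0-based) with i = 4m + r
-- (0 ≤ r < 4) corresponds to the paper's g_{4m+r+1}:
-- r = 0 ↦ x^m, r = 1 ↦ x^m u, r = 2 ↦ x^m v, r = 3 ↦ x^m uv.
uvPart : Fin 4 → Bool × Bool
uvPart F.zero = false , false
uvPart (F.suc F.zero) = true , false
uvPart (F.suc (F.suc F.zero)) = false , true
uvPart (F.suc (F.suc (F.suc F.zero))) = true , true

g : (t : ℕ) → Fin (t ℕ.* 4) → G t
g t i with remQuot {t} 4 i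
... | m , r = m , uvPart r

δ : (t : ℕ) → Fin (t ℕ.* 4) → G t → ℤ
δ t i h with ≡-dec FP._≟_ (≡-dec BP._≟_ BP._≟_) h (g t i)
... | yes _ = - (+ 1)
... | no _ = + 1

N : (t : ℕ) .{{_ : NonZero t}} → Fin (t ℕ.* 4) → Fin (t ℕ.* 4) → Fin (t ℕ.* 4) → ℤ
N t i s j = δ t i (g t j) ℤ.* δ t i (mul (g t s) (g t j))

-- adjacency in the graph, using the row with index `row`
-- (the statement instantiates `row` with the paper's row 5, 0-based index 4):
-- distinct N_i, N_k with a -1 entry in a common position of that row
Adj : (t : ℕ) .{{_ : NonZero t}} → Fin (t ℕ.* 4) → Fin (t ℕ.* 4) → Fin (t ℕ.* 4) → Set
Adj t row i k = ¬ (i ≡ k) × ∃ λ j → (N t i row j ≡ - (+ 1)) × (N t k row j ≡ - (+ 1))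

-- the four claimed cycles: cycle r (r = 0,1,2,3 for the paper's four cycles),
-- position m (0 ≤ m < t) is the vertex N_{4(t-1-m)+r+1} in the paper's numbering,
-- i.e. cycle r lists N_{4t-3+r}, N_{4t-7+r}, ..., N_{5+r}, N_{1+r} (then back to the start).
cycleVertex : (t : ℕ) → Fin 4 × Fin t → Fin (t ℕ.* 4)
cycleVertex t (r , m) = combine (opposite m) r

CycleEdge : (t : ℕ) .{{_ : NonZero t}} → Fin (t ℕ.* 4) → Fin (t ℕ.* 4) → Set
CycleEdge t i k = ∃ λ (r : Fin 4) → ∃ λ (m : Fin t) →
  let m' = m +ₜ fromℕ< (m%n<n 1 t) in
  ((i ≡ cycleVertex t (r , m)) × (k ≡ cycleVertex t (r , m')))
  ⊎ ((k ≡ cycleVertex t (r , m)) × (i ≡ cycleVertex t (r , m')))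

-- Row 5 of the generalized coboundary matrices is indexed by g₅ = x. Since δᵢ takes the
-- value −1 only at gᵢ, the entry (5, j) of Nᵢ is −1 exactly when gᵢ ∈ {gⱼ, x gⱼ}, so Nᵢ and
-- Nₖ share a −1 in row 5 iff gₖ = x gᵢ or gᵢ = x gₖ: the graph is the Cayley graph of G for
-- the generator x. Its components are the four cosets of ⟨x⟩ ≅ ℤ_t, each a t-cycle: position
-- m of cycle r is x^{t−1−m}·w_r with w_r ∈ {1, u, v, uv}, so consecutive positions differ by x.
module Submission where

open import Defs
open import Data.Nat using (ℕ; NonZero; _<_)
open import Data.Nat.DivMod using (_%_)
open import Data.Fin using (Fin; toℕ)
open import Data.Product using (_×_)
open import Function.Bundles using (_⇔_)
open import Function.Definitions using (Bijective)
open import Relation.Binary.PropositionalEquality using (_≡_)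

open import Data.Nat using (_+_; _*_; _∸_; suc)
open import Data.Nat.Properties using (+-comm; +-assoc; m∸n+n≡m; <⇒≤; 1+n≢0)
open import Data.Nat.DivMod
  using (m%n<n; m<n⇒m%n≡m; n%n≡0; m%n%n≡m%n; [m+n]%n≡m%n; %-distribˡ-+)
open import Data.Fin using (fromℕ<; remQuot; combine; opposite)
  renaming (zero to 0F; suc to sucF)
open import Data.Fin.Properties as Fin
  using (toℕ-injective; toℕ-fromℕ<; toℕ<n; remQuot-combine; combine-remQuot; toℕ-combine;
         opposite-prop; opposite-involutive)
open import Data.Bool using (Bool; true; false; _xor_)
open import Data.Bool.Properties as Bool using (not-injective)
open import Data.Product using (∃; _,_; proj₁; proj₂)
open import Data.Product.Properties using (≡-dec)
open import Data.Sum using (_⊎_; inj₁; inj₂)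
open import Data.Empty using (⊥-elim)
open import Data.Integer as ℤ using (+_; -_)
open import Relation.Nullary using (Dec; yes; no)
open import Relation.Binary.PropositionalEquality
  using (refl; sym; trans; cong; cong₂; subst; _≢_; module ≡-Reasoning)
open import Function.Bundles using (mk⇔)
open import Function.Consequences.Propositional
  using (inverseᵇ⇒bijective; strictlyInverseˡ⇒inverseˡ; strictlyInverseʳ⇒inverseʳ)
open import Function.Properties.Equivalence using () renaming (trans to ⇔-trans)

open ≡-Reasoning

[m%d+n]%d≡[m+n]%d : ∀ m n d .{{_ : NonZero d}} → (m % d + n) % d ≡ (m + n) % d
[m%d+n]%d≡[m+n]%d m n d = begin
  (m % d + n) % d          ≡⟨ %-distribˡ-+ (m % d) n d ⟩
  (m % d % d + n % d) % d  ≡⟨ cong (λ k → (k + n % d) % d) (m%n%n≡m%n m d) ⟩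
  (m % d + n % d) % d      ≡⟨ %-distribˡ-+ m n d ⟨
  (m + n) % d              ∎

[m+n%d]%d≡[m+n]%d : ∀ m n d .{{_ : NonZero d}} → (m + n % d) % d ≡ (m + n) % d
[m+n%d]%d≡[m+n]%d m n d = begin
  (m + n % d) % d  ≡⟨ cong (_% d) (+-comm m (n % d)) ⟩
  (n % d + m) % d  ≡⟨ [m%d+n]%d≡[m+n]%d n m d ⟩
  (n + m) % d      ≡⟨ cong (_% d) (+-comm n m) ⟩
  (m + n) % d      ∎

module _ {t : ℕ} .{{_ : NonZero t}} where

  1ₜ : Fin t
  1ₜ = fromℕ< (m%n<n 1 t)

  toℕ-1ₜ : 1 < t → toℕ 1ₜ ≡ 1
  toℕ-1ₜ 1<t = trans (toℕ-fromℕ< _) (m<n⇒m%n≡m 1<t)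

  toℕ-+ₜ : (a b : Fin t) → toℕ (a +ₜ b) ≡ (toℕ a + toℕ b) % t
  toℕ-+ₜ a b = toℕ-fromℕ< _

  +ₜ-comm : (a b : Fin t) → a +ₜ b ≡ b +ₜ a
  +ₜ-comm a b = toℕ-injective (begin
    toℕ (a +ₜ b)           ≡⟨ toℕ-+ₜ a b ⟩
    (toℕ a + toℕ b) % t    ≡⟨ cong (_% t) (+-comm (toℕ a) (toℕ b)) ⟩
    (toℕ b + toℕ a) % t    ≡⟨ toℕ-+ₜ b a ⟨
    toℕ (b +ₜ a)           ∎)

  +ₜ-assoc : (a b c : Fin t) → (a +ₜ b) +ₜ c ≡ a +ₜ (b +ₜ c)
  +ₜ-assoc a b c = toℕ-injective (begin
    toℕ ((a +ₜ b) +ₜ c)                ≡⟨ toℕ-+ₜ (a +ₜ b) c ⟩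
    (toℕ (a +ₜ b) + toℕ c) % t         ≡⟨ cong (λ k → (k + toℕ c) % t) (toℕ-+ₜ a b) ⟩
    ((toℕ a + toℕ b) % t + toℕ c) % t  ≡⟨ [m%d+n]%d≡[m+n]%d (toℕ a + toℕ b) (toℕ c) t ⟩
    (toℕ a + toℕ b + toℕ c) % t        ≡⟨ cong (_% t) (+-assoc (toℕ a) (toℕ b) (toℕ c)) ⟩
    (toℕ a + (toℕ b + toℕ c)) % t      ≡⟨ [m+n%d]%d≡[m+n]%d (toℕ a) (toℕ b + toℕ c) t ⟨
    (toℕ a + (toℕ b + toℕ c) % t) % t  ≡⟨ cong (λ k → (toℕ a + k) % t) (toℕ-+ₜ b c) ⟨
    (toℕ a + toℕ (b +ₜ c)) % t         ≡⟨ toℕ-+ₜ a (b +ₜ c) ⟨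
    toℕ (a +ₜ (b +ₜ c))                ∎)

  [t∸a+[a+ₜb]]%t≡b : (a b : Fin t) → (t ∸ toℕ a + toℕ (a +ₜ b)) % t ≡ toℕ b
  [t∸a+[a+ₜb]]%t≡b a b = begin
    (t ∸ toℕ a + toℕ (a +ₜ b)) % t        ≡⟨ cong (λ k → (t ∸ toℕ a + k) % t) (toℕ-+ₜ a b) ⟩
    (t ∸ toℕ a + (toℕ a + toℕ b) % t) % t ≡⟨ [m+n%d]%d≡[m+n]%d (t ∸ toℕ a) (toℕ a + toℕ b) t ⟩
    (t ∸ toℕ a + (toℕ a + toℕ b)) % t     ≡⟨ cong (_% t) (+-assoc (t ∸ toℕ a) (toℕ a) (toℕ b)) ⟨
    (t ∸ toℕ a + toℕ a + toℕ b) % t       ≡⟨ cong (λ k → (k + toℕ b) % t) (m∸n+n≡m (<⇒≤ (toℕ<n a))) ⟩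
    (t + toℕ b) % t                       ≡⟨ cong (_% t) (+-comm t (toℕ b)) ⟩
    (toℕ b + t) % t                       ≡⟨ [m+n]%n≡m%n (toℕ b) t ⟩
    toℕ b % t                             ≡⟨ m<n⇒m%n≡m (toℕ<n b) ⟩
    toℕ b                                 ∎

  +ₜ-cancelˡ : ∀ a {b c} → a +ₜ b ≡ a +ₜ c → b ≡ c
  +ₜ-cancelˡ a {b} {c} a+b≡a+c = toℕ-injective (begin
    toℕ b                           ≡⟨ [t∸a+[a+ₜb]]%t≡b a b ⟨
    (t ∸ toℕ a + toℕ (a +ₜ b)) % t  ≡⟨ cong (λ y → (t ∸ toℕ a + toℕ y) % t) a+b≡a+c ⟩
    (t ∸ toℕ a + toℕ (a +ₜ c)) % t  ≡⟨ [t∸a+[a+ₜb]]%t≡b a c ⟩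
    toℕ c                           ∎)

  +ₜ-cancelʳ : ∀ a {b c} → b +ₜ a ≡ c +ₜ a → b ≡ c
  +ₜ-cancelʳ a {b} {c} b+a≡c+a =
    +ₜ-cancelˡ a (trans (+ₜ-comm a b) (trans b+a≡c+a (+ₜ-comm c a)))

  a+ₜb≡a⇒toℕ[b]≡0 : ∀ a b → a +ₜ b ≡ a → toℕ b ≡ 0
  a+ₜb≡a⇒toℕ[b]≡0 a b a+b≡a = begin
    toℕ b                           ≡⟨ [t∸a+[a+ₜb]]%t≡b a b ⟨
    (t ∸ toℕ a + toℕ (a +ₜ b)) % t  ≡⟨ cong (λ y → (t ∸ toℕ a + toℕ y) % t) a+b≡a ⟩
    (t ∸ toℕ a + toℕ a) % t         ≡⟨ cong (_% t) (m∸n+n≡m (<⇒≤ (toℕ<n a))) ⟩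
    t % t                           ≡⟨ n%n≡0 t ⟩
    0                               ∎

  1ₜ+ₜa≢a : 1 < t → ∀ a → 1ₜ +ₜ a ≢ a
  1ₜ+ₜa≢a 1<t a 1+a≡a =
    1+n≢0 (trans (sym (toℕ-1ₜ 1<t)) (a+ₜb≡a⇒toℕ[b]≡0 a 1ₜ (trans (+ₜ-comm a 1ₜ) 1+a≡a)))

  toℕ-+ₜ1ₜ : ∀ a → toℕ (a +ₜ 1ₜ) ≡ suc (toℕ a) % t
  toℕ-+ₜ1ₜ a = begin
    toℕ (a +ₜ 1ₜ)            ≡⟨ toℕ-+ₜ a 1ₜ ⟩
    (toℕ a + toℕ 1ₜ) % t     ≡⟨ cong (λ k → (toℕ a + k) % t) (toℕ-fromℕ< _) ⟩
    (toℕ a + 1 % t) % t      ≡⟨ [m+n%d]%d≡[m+n]%d (toℕ a) 1 t ⟩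
    (toℕ a + 1) % t          ≡⟨ cong (_% t) (+-comm (toℕ a) 1) ⟩
    suc (toℕ a) % t          ∎

  opposite-+ₜ-inverse : ∀ a → toℕ (opposite a +ₜ (a +ₜ 1ₜ)) ≡ 0
  opposite-+ₜ-inverse a = begin
    toℕ (opposite a +ₜ (a +ₜ 1ₜ))            ≡⟨ toℕ-+ₜ (opposite a) (a +ₜ 1ₜ) ⟩
    (toℕ (opposite a) + toℕ (a +ₜ 1ₜ)) % t   ≡⟨ cong₂ (λ m n → (m + n) % t) (opposite-prop a) (toℕ-+ₜ1ₜ a) ⟩
    (t ∸ suc (toℕ a) + suc (toℕ a) % t) % t  ≡⟨ [m+n%d]%d≡[m+n]%d (t ∸ suc (toℕ a)) (suc (toℕ a)) t ⟩
    (t ∸ suc (toℕ a) + suc (toℕ a)) % t      ≡⟨ cong (_% t) (m∸n+n≡m (toℕ<n a)) ⟩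
    t % t                                    ≡⟨ n%n≡0 t ⟩
    0                                        ∎

  1ₜ+ₜopposite[a+ₜ1ₜ]≡opposite[a] : ∀ a → 1ₜ +ₜ opposite (a +ₜ 1ₜ) ≡ opposite a
  1ₜ+ₜopposite[a+ₜ1ₜ]≡opposite[a] a = +ₜ-cancelʳ (a +ₜ 1ₜ) (toℕ-injective (begin
    toℕ ((1ₜ +ₜ o) +ₜ w)      ≡⟨ cong (λ y → toℕ (y +ₜ w)) (+ₜ-comm 1ₜ o) ⟩
    toℕ ((o +ₜ 1ₜ) +ₜ w)      ≡⟨ cong toℕ (+ₜ-assoc o 1ₜ w) ⟩
    toℕ (o +ₜ (1ₜ +ₜ w))      ≡⟨ cong (λ y → toℕ (o +ₜ y)) (+ₜ-comm 1ₜ w) ⟩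
    toℕ (o +ₜ (w +ₜ 1ₜ))      ≡⟨ opposite-+ₜ-inverse w ⟩
    0                         ≡⟨ opposite-+ₜ-inverse a ⟨
    toℕ (opposite a +ₜ w)     ∎))
    where
    w o : Fin t
    w = a +ₜ 1ₜ
    o = opposite w

  x : G t
  x = 1ₜ , false , false

  xor-cancelˡ : ∀ a {b c} → a xor b ≡ a xor c → b ≡ c
  xor-cancelˡ false a⊕b≡a⊕c = a⊕b≡a⊕c
  xor-cancelˡ true  a⊕b≡a⊕c = not-injective a⊕b≡a⊕c

  mul-cancelˡ : ∀ a {h h′} → mul a h ≡ mul a h′ → h ≡ h′
  mul-cancelˡ (a , b , c) ah≡ah′ =
    cong₂ _,_ (+ₜ-cancelˡ a (cong proj₁ ah≡ah′))
      (cong₂ _,_ (xor-cancelˡ b (cong (λ h → proj₁ (proj₂ h)) ah≡ah′))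
                 (xor-cancelˡ c (cong (λ h → proj₂ (proj₂ h)) ah≡ah′)))

  x·h≢h : 1 < t → ∀ h → mul x h ≢ h
  x·h≢h 1<t (a , _) xh≡h = 1ₜ+ₜa≢a 1<t a (cong proj₁ xh≡h)

uvIndex : Bool × Bool → Fin 4
uvIndex (false , false) = 0F
uvIndex (true  , false) = sucF 0F
uvIndex (false , true)  = sucF (sucF 0F)
uvIndex (true  , true)  = sucF (sucF (sucF 0F))

uvIndex-uvPart : ∀ r → uvIndex (uvPart r) ≡ r
uvIndex-uvPart 0F                      = refl
uvIndex-uvPart (sucF 0F)               = refl
uvIndex-uvPart (sucF (sucF 0F))        = refl
uvIndex-uvPart (sucF (sucF (sucF 0F))) = refl

module _ {t : ℕ} .{{_ : NonZero t}} where

  g-combine : ∀ (a : Fin t) r → g t (combine a r) ≡ (a , uvPart r)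
  g-combine a r = cong (λ (m , r) → m , uvPart r) (remQuot-combine a r)

  index : G t → Fin (t * 4)
  index (a , p) = combine a (uvIndex p)

  index-g : ∀ i → index (g t i) ≡ i
  index-g i = trans (cong (combine {t} _) (uvIndex-uvPart _)) (combine-remQuot {t} 4 i)

  g-injective : ∀ {i j} → g t i ≡ g t j → i ≡ j
  g-injective {i} {j} gi≡gj = trans (sym (index-g i)) (trans (cong index gi≡gj) (index-g j))

  _≟G_ : (h h′ : G t) → Dec (h ≡ h′)
  _≟G_ = ≡-dec Fin._≟_ (≡-dec Bool._≟_ Bool._≟_)

  δ-≡ : ∀ {i h} → h ≡ g t i → δ t i h ≡ - (+ 1)
  δ-≡ {i} {h} h≡gi with h ≟G g t i
  ... | yes _   = refl
  ... | no h≢gi = ⊥-elim (h≢gi h≡gi)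

  δ-≢ : ∀ {i h} → h ≢ g t i → δ t i h ≡ + 1
  δ-≢ {i} {h} h≢gi with h ≟G g t i
  ... | yes h≡gi = ⊥-elim (h≢gi h≡gi)
  ... | no _     = refl

  N≡-1⇒ : ∀ {s i j} → N t i s j ≡ - (+ 1) → g t j ≡ g t i ⊎ mul (g t s) (g t j) ≡ g t i
  N≡-1⇒ {s} {i} {j} Nᵢ≡-1 = decide (g t j ≟G g t i) (mul (g t s) (g t j) ≟G g t i)
    where
    decide : Dec (g t j ≡ g t i) → Dec (mul (g t s) (g t j) ≡ g t i) →
             g t j ≡ g t i ⊎ mul (g t s) (g t j) ≡ g t i
    decide (yes gⱼ≡gᵢ) _            = inj₁ gⱼ≡gᵢ
    decide (no _)      (yes agⱼ≡gᵢ) = inj₂ agⱼ≡gᵢ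
    decide (no gⱼ≢gᵢ)  (no agⱼ≢gᵢ)
      with () ← trans (sym Nᵢ≡-1) (cong₂ ℤ._*_ (δ-≢ gⱼ≢gᵢ) (δ-≢ agⱼ≢gᵢ))

  N≡-1⇐ : ∀ {s i j} → (∀ h → mul (g t s) h ≢ h) →
          g t j ≡ g t i ⊎ mul (g t s) (g t j) ≡ g t i → N t i s j ≡ - (+ 1)
  N≡-1⇐ fixedPointFree (inj₁ gⱼ≡gᵢ) =
    cong₂ ℤ._*_ (δ-≡ gⱼ≡gᵢ) (δ-≢ λ agⱼ≡gᵢ → fixedPointFree _ (trans agⱼ≡gᵢ (sym gⱼ≡gᵢ)))
  N≡-1⇐ fixedPointFree (inj₂ agⱼ≡gᵢ) =
    cong₂ ℤ._*_ (δ-≢ λ gⱼ≡gᵢ → fixedPointFree _ (trans agⱼ≡gᵢ (sym gⱼ≡gᵢ))) (δ-≡ agⱼ≡gᵢ)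

  CayleyEdge : G t → Fin (t * 4) → Fin (t * 4) → Set
  CayleyEdge a i k = g t k ≡ mul a (g t i) ⊎ g t i ≡ mul a (g t k)

  Adj⇔CayleyEdge : ∀ {s} → (∀ h → mul (g t s) h ≢ h) → ∀ i k → Adj t s i k ⇔ CayleyEdge (g t s) i k
  Adj⇔CayleyEdge {s} fixedPointFree i k = mk⇔ to from
    where
    a : G t
    a = g t s

    to : Adj t s i k → CayleyEdge a i k
    to (i≢k , j , Nᵢ≡-1 , Nₖ≡-1) with N≡-1⇒ {s} Nᵢ≡-1 | N≡-1⇒ {s} Nₖ≡-1
    ... | inj₁ gⱼ≡gᵢ  | inj₁ gⱼ≡gₖ  = ⊥-elim (i≢k (g-injective (trans (sym gⱼ≡gᵢ) gⱼ≡gₖ)))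
    ... | inj₁ gⱼ≡gᵢ  | inj₂ agⱼ≡gₖ = inj₁ (trans (sym agⱼ≡gₖ) (cong (mul a) gⱼ≡gᵢ))
    ... | inj₂ agⱼ≡gᵢ | inj₁ gⱼ≡gₖ  = inj₂ (trans (sym agⱼ≡gᵢ) (cong (mul a) gⱼ≡gₖ))
    ... | inj₂ agⱼ≡gᵢ | inj₂ agⱼ≡gₖ = ⊥-elim (i≢k (g-injective (trans (sym agⱼ≡gᵢ) agⱼ≡gₖ)))

    from : CayleyEdge a i k → Adj t s i k
    from (inj₁ gₖ≡agᵢ) = (λ { refl → fixedPointFree _ (sym gₖ≡agᵢ) }) ,
      i , N≡-1⇐ fixedPointFree (inj₁ refl) , N≡-1⇐ fixedPointFree (inj₂ (sym gₖ≡agᵢ))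
    from (inj₂ gᵢ≡agₖ) = (λ { refl → fixedPointFree _ (sym gᵢ≡agₖ) }) ,
      k , N≡-1⇐ fixedPointFree (inj₂ (sym gᵢ≡agₖ)) , N≡-1⇐ fixedPointFree (inj₁ refl)

  cycleIndex : Fin (t * 4) → Fin 4 × Fin t
  cycleIndex i = proj₂ (remQuot {t} 4 i) , opposite (proj₁ (remQuot {t} 4 i))

  cycleVertex-cycleIndex : ∀ i → cycleVertex t (cycleIndex i) ≡ i
  cycleVertex-cycleIndex i =
    trans (cong (λ m → combine {t} m (proj₂ (remQuot {t} 4 i))) (opposite-involutive _))
          (combine-remQuot {t} 4 i)

  cycleIndex-cycleVertex : ∀ p → cycleIndex (cycleVertex t p) ≡ p
  cycleIndex-cycleVertex (r , m) =
    trans (cong (λ (m′ , r′) → r′ , opposite m′) (remQuot-combine (opposite m) r))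
          (cong (r ,_) (opposite-involutive m))

  cycleVertex-bijective : Bijective _≡_ _≡_ (cycleVertex t)
  cycleVertex-bijective = inverseᵇ⇒bijective
    ( strictlyInverseˡ⇒inverseˡ (cycleVertex t) cycleVertex-cycleIndex
    , strictlyInverseʳ⇒inverseʳ (cycleVertex t) cycleIndex-cycleVertex )

  g-cycleVertex : ∀ r m → g t (cycleVertex t (r , m)) ≡ (opposite m , uvPart r)
  g-cycleVertex r m = g-combine (opposite m) r

  g-cycleVertex-step : ∀ r m → g t (cycleVertex t (r , m)) ≡ mul x (g t (cycleVertex t (r , m +ₜ 1ₜ)))
  g-cycleVertex-step r m = begin
    g t (cycleVertex t (r , m))                ≡⟨ g-cycleVertex r m ⟩
    (opposite m , uvPart r)                    ≡⟨ cong (_, uvPart r) (1ₜ+ₜopposite[a+ₜ1ₜ]≡opposite[a] m) ⟨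
    mul x (opposite (m +ₜ 1ₜ) , uvPart r)      ≡⟨ cong (mul x) (g-cycleVertex r (m +ₜ 1ₜ)) ⟨
    mul x (g t (cycleVertex t (r , m +ₜ 1ₜ)))  ∎

  x-step⇒cycleStep : ∀ {i k} → g t i ≡ mul x (g t k) →
    ∃ λ r → ∃ λ m → i ≡ cycleVertex t (r , m) × k ≡ cycleVertex t (r , m +ₜ 1ₜ)
  x-step⇒cycleStep {i} {k} gᵢ≡xgₖ = r , m , sym i≡v , g-injective (mul-cancelˡ x (begin
    mul x (g t k)                              ≡⟨ gᵢ≡xgₖ ⟨
    g t i                                      ≡⟨ cong (g t) i≡v ⟨
    g t (cycleVertex t (r , m))                ≡⟨ g-cycleVertex-step r m ⟩
    mul x (g t (cycleVertex t (r , m +ₜ 1ₜ)))  ∎))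
    where
    r : Fin 4
    r = proj₁ (cycleIndex i)
    m : Fin t
    m = proj₂ (cycleIndex i)
    i≡v : cycleVertex t (r , m) ≡ i
    i≡v = cycleVertex-cycleIndex i

  CayleyEdge⇔CycleEdge : ∀ i k → CayleyEdge x i k ⇔ CycleEdge t i k
  CayleyEdge⇔CycleEdge i k = mk⇔ to from
    where
    to : CayleyEdge x i k → CycleEdge t i k
    to (inj₁ gₖ≡xgᵢ) with r , m , k≡v , i≡v′ ← x-step⇒cycleStep gₖ≡xgᵢ = r , m , inj₂ (k≡v , i≡v′)
    to (inj₂ gᵢ≡xgₖ) with r , m , i≡v , k≡v′ ← x-step⇒cycleStep gᵢ≡xgₖ = r , m , inj₁ (i≡v , k≡v′)

    from : CycleEdge t i k → CayleyEdge x i k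
    from (r , m , inj₁ (refl , refl)) = inj₂ (g-cycleVertex-step r m)
    from (r , m , inj₂ (refl , refl)) = inj₁ (g-cycleVertex-step r m)

  toℕ≡4⇒g≡x : 1 < t → ∀ {s} → toℕ s ≡ 4 → g t s ≡ x
  toℕ≡4⇒g≡x 1<t {s} s≡4 = trans (cong (g t) s≡x-index) (g-combine 1ₜ 0F)
    where
    s≡x-index : s ≡ combine 1ₜ 0F
    s≡x-index = toℕ-injective (trans s≡4
      (sym (trans (toℕ-combine 1ₜ (0F {3})) (cong (λ n → 4 * n + 0) (toℕ-1ₜ 1<t)))))

corollary2 : (t : ℕ) .{{_ : NonZero t}} → 1 < t → t % 2 ≡ 1 →
    (row5 : Fin (t Data.Nat.* 4)) → toℕ row5 ≡ 4 →
    Bijective _≡_ _≡_ (cycleVertex t)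
    × (∀ i k → Adj t row5 i k ⇔ CycleEdge t i k)
corollary2 t 1<t _ row5 row5≡4 =
  cycleVertex-bijective ,
  λ i k → ⇔-trans (Adj⇔CayleyEdge fixedPointFree i k)
                  (subst (λ a → CayleyEdge a i k ⇔ CycleEdge t i k) (sym gRow5≡x) (CayleyEdge⇔CycleEdge i k))
  where
  gRow5≡x : g t row5 ≡ x
  gRow5≡x = toℕ≡4⇒g≡x 1<t row5≡4

  fixedPointFree : ∀ h → mul (g t row5) h ≢ h
  fixedPointFree = subst (λ a → ∀ h → mul a h ≢ h) (sym gRow5≡x) (x·h≢h 1<t)
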